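{- For every positive integer $n$ and every permutation $\pi\in S_k$, $L_n(\pi)=L_n(\pi^{\mathrm{rev}})=L_n(\pi^c)$, where $\pi^{\mathrm{rev}}(i)=\pi(k+1-i)$ is the reverse of $\pi$ and $\pi^c(i)=(k+1)-\pi(i)$ is the complement of $\pi$.
   Context: An $n$-th order Latin Square is an $n\times n$ grid filled with the symbols $1,\dots,n$ such that each symbol appears exactly once in each row and each column. Rows read left to right and columns read top to bottom give permutations of $\{1,\dots,n\}$. A permutation contains a pattern $\pi$ if some subsequence is order isomorphic to $\pi$, and avoids it otherwise. A Latin Square avoids $\pi$ if all its row and column permutations avoid $\pi$; $L_n(\pi)$ denotes the number of $n$-th order Latin Squares avoiding $\pi$. -}

module Defs where

open import Data.Nat using (ℕ; zero; suc; _+_)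
open import Data.Fin using (Fin; zero; suc; _<_; opposite)
open import Data.Fin.Properties using (any?; all?; _<?_; _≟_)
open import Data.Fin.Permutation using (Permutation′; _⟨$⟩ʳ_)
open import Data.Vec using (Vec; []; _∷_; lookup)
open import Data.Product using (Σ; ∃; _×_; _,_)
open import Data.Bool using (true; false)
open import Relation.Nullary using (¬_; Dec; does; ¬?; _×-dec_; _→-dec_)
open import Relation.Nullary.Decidable using (map′)
open import Relation.Unary using (Decidable)
open import Relation.Binary.PropositionalEquality using (_≡_)
open import Function.Bundles using (_⇔_; mk⇔; Equivalence)

-- Permutations of {1..k}, represented as Fin k (0-based) bijections.
-- Reverse and complement.  With 0-based indices, k+1-i becomes
-- opposite i = k-1-i.

reverse : ∀ {k} → Permutation′ k → (Fin k → Fin k)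
reverse π i = π ⟨$⟩ʳ (opposite i)

complement : ∀ {k} → Permutation′ k → (Fin k → Fin k)
complement π i = opposite (π ⟨$⟩ʳ i)

Contains : ∀ {n k} → (Fin n → Fin n) → (Fin k → Fin k) → Set
Contains {n} {k} σ π =
  Σ (Vec (Fin n) k) λ ι →
    (∀ i j → i < j → lookup ι i < lookup ι j) ×
    (∀ i j → (π i < π j) ⇔ (σ (lookup ι i) < σ (lookup ι j)))

Avoids : ∀ {n k} → (Fin n → Fin n) → (Fin k → Fin k) → Set
Avoids σ π = ¬ Contains σ π

Grid : ℕ → Set
Grid n = Vec (Vec (Fin n) n) n

row : ∀ {n} → Grid n → Fin n → (Fin n → Fin n)
row L r c = lookup (lookup L r) c

col : ∀ {n} → Grid n → Fin n → (Fin n → Fin n)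
col L c r = lookup (lookup L r) c

ExactlyOnce : ∀ {n} → (Fin n → Fin n) → Set
ExactlyOnce {n} f = ∀ (s : Fin n) → Σ (Fin n) λ j → (f j ≡ s) × (∀ j' → f j' ≡ s → j' ≡ j)

IsLatin : ∀ {n} → Grid n → Set
IsLatin {n} L = (∀ r → ExactlyOnce (row L r)) × (∀ c → ExactlyOnce (col L c))

LatinAvoids : ∀ {n k} → (Fin k → Fin k) → Grid n → Set
LatinAvoids π L = IsLatin L × (∀ r → Avoids (row L r) π) × (∀ c → Avoids (col L c) π)

sumFin : ∀ n → (Fin n → ℕ) → ℕ
sumFin zero    f = 0
sumFin (suc n) f = f zero + sumFin n (λ i → f (suc i))

sumVec : ∀ {A : Set} → ((A → ℕ) → ℕ) → ∀ m → (Vec A m → ℕ) → ℕ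
sumVec sA zero    f = f []
sumVec sA (suc m) f = sA (λ a → sumVec sA m (λ v → f (a ∷ v)))

sumGrid : ∀ n → (Grid n → ℕ) → ℕ
sumGrid n = sumVec (sumVec (sumFin n) n) n

indicator : ∀ {A : Set} {P : A → Set} → Decidable P → A → ℕ
indicator P? a with does (P? a)
... | true  = 1
... | false = 0

∃Vec? : ∀ {n} m {P : Vec (Fin n) m → Set} →
  (∀ v → Dec (P v)) → Dec (Σ (Vec (Fin n) m) P)
∃Vec? zero P? = map′ (λ p → [] , p) (λ { ([] , p) → p }) (P? [])
∃Vec? (suc m) {P} P? =
  map′ (λ { (a , v , p) → a ∷ v , p }) (λ { (a ∷ v , p) → a , v , p })
       (any? (λ a → ∃Vec? m (λ v → P? (a ∷ v))))

⇔? : ∀ {A B : Set} → Dec A → Dec B → Dec (A ⇔ B)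
⇔? a b = map′ (λ (f , g) → mk⇔ f g) (λ e → Equivalence.to e , Equivalence.from e)
              ((a →-dec b) ×-dec (b →-dec a))

contains? : ∀ {n k} (σ : Fin n → Fin n) (π : Fin k → Fin k) → Dec (Contains σ π)
contains? {n} {k} σ π = ∃Vec? k (λ ι →
  all? (λ i → all? (λ j → (i <? j) →-dec (lookup ι i <? lookup ι j))) ×-dec
  all? (λ i → all? (λ j → ⇔? (π i <? π j) (σ (lookup ι i) <? σ (lookup ι j)))))

exactlyOnce? : ∀ {n} (f : Fin n → Fin n) → Dec (ExactlyOnce f)
exactlyOnce? f = all? (λ s → any? (λ j →
  (f j ≟ s) ×-dec all? (λ j' → (f j' ≟ s) →-dec (j' ≟ j))))

latinAvoids? : ∀ {n k} (π : Fin k → Fin k) → Decidable (LatinAvoids {n} π)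
latinAvoids? π G =
  ((all? λ r → exactlyOnce? (row G r)) ×-dec (all? λ c → exactlyOnce? (col G c)))
  ×-dec ((all? λ r → ¬? (contains? (row G r) π))
  ×-dec (all? λ c → ¬? (contains? (col G c) π)))

L : ∀ n {k} (π : Fin k → Fin k) → ℕ
L n π = sumGrid n (indicator (latinAvoids? π))

module Submission where

-- The theorem follows
-- from two symmetries of grids:
--   * complementing every entry (s ↦ n+1-s) maps the rows and columns of G
--     to their complements, so G avoids π iff its complement avoids π^c;
--   * rotating G by 180° maps every row and column of G to the reverse of
--     another row or column, so G avoids π iff its rotation avoids π^rev.
-- Both maps are bijections of the set of grids, hence  L n π = L n π^c
-- and  L n π = L n π^rev , which gives both equalities of the theorem.

open import Defs
open import Data.Nat using (ℕ; _≤_; suc; _+_; s≤s)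
import Data.Nat as Nat
open import Data.Nat.Properties using (+-0-commutativeMonoid; ∸-monoʳ-<)
open import Data.Fin using (Fin; zero; suc; opposite; fromℕ; inject₁; _<_)
open import Data.Fin.Properties using (opposite-involutive; opposite-prop; toℕ<n)
open import Data.Fin.Permutation as Perm using (Permutation′; _⟨$⟩ʳ_)
open import Data.Vec using (Vec; []; _∷_; _∷ʳ_; lookup; map; tabulate)
import Data.Vec as Vec
open import Data.Vec.Properties using (lookup-map; lookup∘tabulate; reverse-∷)
open import Data.Product using (_×_; _,_)
open import Relation.Nullary using (yes; no)
open import Relation.Unary using (Decidable)
open import Relation.Binary.PropositionalEquality
  using (_≡_; _≗_; refl; sym; trans; cong; cong₂; subst; subst₂; module ≡-Reasoning)
open import Function using (_∘_)
open import Function.Bundles using (_⇔_; mk⇔; Equivalence)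
open import Data.Empty using (⊥-elim)
open import Algebra.Properties.CommutativeMonoid.Sum +-0-commutativeMonoid
  using (sum; sum-cong-≗; ∑-distrib-+; sum-replicate-zero; sum-permute)

open Equivalence using (to; from)

Word : ℕ → Set
Word n = Fin n → Fin n

record IsSummation {A : Set} (S : (A → ℕ) → ℕ) : Set where
  field
    S-cong   : ∀ {f g : A → ℕ} → f ≗ g → S f ≡ S g
    additive : ∀ (f g : A → ℕ) → S (λ x → f x + g x) ≡ S f + S g
    of-zero  : S (λ _ → 0) ≡ 0
open IsSummation

CommutesWithSums : ∀ {A : Set} → ((A → ℕ) → ℕ) → Set₁
CommutesWithSums {A} T = ∀ {B : Set} (S : (B → ℕ) → ℕ) → IsSummation S →
  ∀ (f : B → A → ℕ) → S (λ b → T (f b)) ≡ T (λ a → S (λ b → f b a))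

sumFin≡sum : ∀ n (f : Fin n → ℕ) → sumFin n f ≡ sum f
sumFin≡sum Nat.zero  f = refl
sumFin≡sum (suc n) f = cong (f zero +_) (sumFin≡sum n (f ∘ suc))

sumFin-isSummation : ∀ n → IsSummation (sumFin n)
sumFin-isSummation n = record
  { S-cong   = λ {f} {g} f≗g → trans (sumFin≡sum n f)
                 (trans (sum-cong-≗ f≗g) (sym (sumFin≡sum n g)))
  ; additive = λ f g → trans (sumFin≡sum n _)
                 (trans (∑-distrib-+ f g)
                   (sym (cong₂ _+_ (sumFin≡sum n f) (sumFin≡sum n g))))
  ; of-zero  = trans (sumFin≡sum n _) (sum-replicate-zero n)
  }

sumFin-commutes : ∀ n → CommutesWithSums (sumFin n)
sumFin-commutes Nat.zero  S isS f = of-zero isS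
sumFin-commutes (suc n) S isS f =
  trans (additive isS (λ b → f b zero) (λ b → sumFin n (f b ∘ suc)))
        (cong (S (λ b → f b zero) +_) (sumFin-commutes n S isS (λ b → f b ∘ suc)))

sumVec-isSummation : ∀ {A : Set} {sA : (A → ℕ) → ℕ} → IsSummation sA →
  ∀ m → IsSummation (sumVec sA m)
sumVec-isSummation isA Nat.zero = record
  { S-cong = λ f≗g → f≗g [] ; additive = λ _ _ → refl ; of-zero = refl }
sumVec-isSummation {sA = sA} isA (suc m) = record
  { S-cong   = λ f≗g → S-cong isA (λ a → S-cong rest (λ v → f≗g (a ∷ v)))
  ; additive = λ f g →
      trans (S-cong isA (λ a → additive rest (λ v → f (a ∷ v)) (λ v → g (a ∷ v))))
            (additive isA _ _)
  ; of-zero  = trans (S-cong isA (λ _ → of-zero rest)) (of-zero isA)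
  }
  where rest = sumVec-isSummation isA m

sumVec-commutes : ∀ {A : Set} {sA : (A → ℕ) → ℕ} → IsSummation sA →
  CommutesWithSums sA → ∀ m → CommutesWithSums (sumVec sA m)
sumVec-commutes isA comA Nat.zero  S isS f = refl
sumVec-commutes isA comA (suc m) S isS f =
  trans (comA S isS (λ b a → sumVec _ m (λ v → f b (a ∷ v))))
        (S-cong isA (λ a → sumVec-commutes isA comA m S isS (λ b v → f b (a ∷ v))))

-- Precomposing with g does not change any sum, i.e. g acts as a bijection.
Invariant : ∀ {A : Set} → ((A → ℕ) → ℕ) → (A → A) → Set
Invariant {A} S g = ∀ (h : A → ℕ) → S (h ∘ g) ≡ S h

invariant-∘ : ∀ {A : Set} {S : (A → ℕ) → ℕ} {g g′ : A → A} →
  Invariant S g → Invariant S g′ → Invariant S (g ∘ g′)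
invariant-∘ {g = g} inv inv′ h = trans (inv′ (h ∘ g)) (inv h)

sumFin-opposite : ∀ n → Invariant (sumFin n) opposite
sumFin-opposite n h = begin
  sumFin n (h ∘ opposite) ≡⟨ sumFin≡sum n (h ∘ opposite) ⟩
  sum (h ∘ opposite)      ≡⟨ sym (sum-permute h Perm.reverse) ⟩
  sum h                   ≡⟨ sym (sumFin≡sum n h) ⟩
  sumFin n h              ∎
  where open ≡-Reasoning

sumVec-map : ∀ {A : Set} {sA : (A → ℕ) → ℕ} {g : A → A} → IsSummation sA →
  Invariant sA g → ∀ m → Invariant (sumVec sA m) (map g)
sumVec-map isA inv Nat.zero  h = refl
sumVec-map {g = g} isA inv (suc m) h =
  trans (S-cong isA (λ a → sumVec-map isA inv m (λ v → h (g a ∷ v))))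
        (inv (λ a → sumVec _ m (λ v → h (a ∷ v))))

sumVec-∷ʳ : ∀ {A : Set} {sA : (A → ℕ) → ℕ} → IsSummation sA →
  ∀ m (f : Vec A (suc m) → ℕ) →
  sumVec sA (suc m) f ≡ sumVec sA m (λ v → sA (λ a → f (v ∷ʳ a)))
sumVec-∷ʳ isA Nat.zero  f = refl
sumVec-∷ʳ isA (suc m) f = S-cong isA (λ b → sumVec-∷ʳ isA m (λ w → f (b ∷ w)))

-- Reversing the order of the coordinates: the first coordinate becomes the
-- last, and Fubini moves its sum back to the front.
sumVec-reverse : ∀ {A : Set} {sA : (A → ℕ) → ℕ} → IsSummation sA →
  CommutesWithSums sA → ∀ m → Invariant (sumVec sA m) Vec.reverse
sumVec-reverse isA comA Nat.zero  f = refl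
sumVec-reverse {sA = sA} isA comA (suc m) f = begin
  sA (λ a → sumVec sA m (λ v → f (Vec.reverse (a ∷ v))))
    ≡⟨ S-cong isA (λ a → S-cong (sumVec-isSummation isA m) (λ v → cong f (reverse-∷ a v))) ⟩
  sA (λ a → sumVec sA m (λ v → f (Vec.reverse v ∷ʳ a)))
    ≡⟨ S-cong isA (λ a → sumVec-reverse isA comA m (λ v → f (v ∷ʳ a))) ⟩
  sA (λ a → sumVec sA m (λ v → f (v ∷ʳ a)))
    ≡⟨ sumVec-commutes isA comA m sA isA (λ a v → f (v ∷ʳ a)) ⟩
  sumVec sA m (λ v → sA (λ a → f (v ∷ʳ a)))
    ≡⟨ sym (sumVec-∷ʳ isA m f) ⟩
  sumVec sA (suc m) f ∎
  where open ≡-Reasoning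

sumRow : ∀ n → (Vec (Fin n) n → ℕ) → ℕ
sumRow n = sumVec (sumFin n) n

sumRow-isSummation : ∀ n → IsSummation (sumRow n)
sumRow-isSummation n = sumVec-isSummation (sumFin-isSummation n) n

sumGrid-isSummation : ∀ n → IsSummation (sumGrid n)
sumGrid-isSummation n = sumVec-isSummation (sumRow-isSummation n) n

sumGrid-complement : ∀ n → Invariant (sumGrid n) (map (map opposite))
sumGrid-complement n = sumVec-map (sumRow-isSummation n)
  (sumVec-map (sumFin-isSummation n) (sumFin-opposite n) n) n

sumGrid-rotate : ∀ n → Invariant (sumGrid n) (map Vec.reverse ∘ Vec.reverse)
sumGrid-rotate n = invariant-∘
  (sumVec-map (sumRow-isSummation n)
    (sumVec-reverse (sumFin-isSummation n) (sumFin-commutes n) n) n)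
  (sumVec-reverse (sumRow-isSummation n)
    (sumVec-commutes (sumFin-isSummation n) (sumFin-commutes n) n) n)

indicator-cong : ∀ {A B : Set} {P : A → Set} {Q : B → Set}
  (P? : Decidable P) (Q? : Decidable Q) {a b} →
  P a ⇔ Q b → indicator P? a ≡ indicator Q? b
indicator-cong P? Q? {a} {b} P⇔Q with P? a | Q? b
... | yes _ | yes _ = refl
... | no  _ | no  _ = refl
... | yes p | no ¬q = ⊥-elim (¬q (to P⇔Q p))
... | no ¬p | yes q = ⊥-elim (¬p (from P⇔Q q))

count-transport : ∀ {A : Set} {S : (A → ℕ) → ℕ} {g : A → A}
  {P Q : A → Set} (P? : Decidable P) (Q? : Decidable Q) →
  IsSummation S → Invariant S g → (∀ x → P (g x) ⇔ Q x) →
  S (indicator P?) ≡ S (indicator Q?)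
count-transport P? Q? isS inv P∘g⇔Q =
  trans (sym (inv (indicator P?))) (S-cong isS (λ x → indicator-cong P? Q? (P∘g⇔Q x)))

opposite-< : ∀ {n} {i j : Fin n} → i < j → opposite j < opposite i
opposite-< {i = i} {j} i<j =
  subst₂ Nat._<_ (sym (opposite-prop j)) (sym (opposite-prop i))
    (∸-monoʳ-< (s≤s i<j) (toℕ<n j))

opposite-<⁻ : ∀ {n} {i j : Fin n} → opposite j < opposite i → i < j
opposite-<⁻ {i = i} {j} o =
  subst₂ _<_ (opposite-involutive i) (opposite-involutive j) (opposite-< o)

ExactlyOnce-cong : ∀ {n} {σ σ′ : Word n} → σ ≗ σ′ → ExactlyOnce σ → ExactlyOnce σ′
ExactlyOnce-cong σ≗σ′ once s with once s
... | j , σj≡s , unique =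
  j , trans (sym (σ≗σ′ j)) σj≡s , λ j′ σ′j′≡s → unique j′ (trans (σ≗σ′ j′) σ′j′≡s)

Contains-cong : ∀ {n k} {σ σ′ : Word n} {π π′ : Fin k → Fin k} →
  σ ≗ σ′ → π ≗ π′ → Contains σ π → Contains σ′ π′
Contains-cong {σ = σ} {π = π} {π′} σ≗σ′ π≗π′ (ι , increasing , iso) =
  ι , increasing , λ i j →
    subst₂ (λ a b → (π′ i < π′ j) ⇔ (a < b)) (σ≗σ′ (lookup ι i)) (σ≗σ′ (lookup ι j))
      (subst₂ (λ a b → (a < b) ⇔ (σ (lookup ι i) < σ (lookup ι j))) (π≗π′ i) (π≗π′ j)
        (iso i j))

Avoids-cong : ∀ {n k} {σ σ′ : Word n} {π : Fin k → Fin k} →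
  σ ≗ σ′ → Avoids σ π → Avoids σ′ π
Avoids-cong σ≗σ′ avoids c = avoids (Contains-cong (sym ∘ σ≗σ′) (λ _ → refl) c)

ExactlyOnce-reverse : ∀ {n} {σ : Word n} → ExactlyOnce σ → ExactlyOnce (σ ∘ opposite)
ExactlyOnce-reverse {σ = σ} once s with once s
... | j , σj≡s , unique =
  opposite j , trans (cong σ (opposite-involutive j)) σj≡s ,
  λ j′ eq → trans (sym (opposite-involutive j′)) (cong opposite (unique (opposite j′) eq))

ExactlyOnce-complement : ∀ {n} {σ : Word n} → ExactlyOnce σ → ExactlyOnce (opposite ∘ σ)
ExactlyOnce-complement {σ = σ} once s with once (opposite s)
... | j , σj≡s , unique =
  j , trans (cong opposite σj≡s) (opposite-involutive s) ,
  λ j′ eq → unique j′ (trans (sym (opposite-involutive (σ j′))) (cong opposite eq))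

-- Reading the occurrence ι backwards gives an occurrence of the reverse.
Contains-reverse : ∀ {n k} {σ : Word n} {π : Fin k → Fin k} →
  Contains σ π → Contains (σ ∘ opposite) (π ∘ opposite)
Contains-reverse {n} {k} {σ} {π} (ι , increasing , iso) = ι′ , increasing′ , iso′
  where
  ι′ : Vec (Fin n) k
  ι′ = tabulate (opposite ∘ lookup ι ∘ opposite)
  lookup-ι′ : ∀ i → opposite (lookup ι′ i) ≡ lookup ι (opposite i)
  lookup-ι′ i = trans (cong opposite (lookup∘tabulate _ i)) (opposite-involutive _)
  increasing′ : ∀ i j → i < j → lookup ι′ i < lookup ι′ j
  increasing′ i j i<j = opposite-<⁻
    (subst₂ _<_ (sym (lookup-ι′ j)) (sym (lookup-ι′ i))
      (increasing (opposite j) (opposite i) (opposite-< i<j)))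
  iso′ : ∀ i j → (π (opposite i) < π (opposite j)) ⇔
                 (σ (opposite (lookup ι′ i)) < σ (opposite (lookup ι′ j)))
  iso′ i j = subst₂ (λ a b → (π (opposite i) < π (opposite j)) ⇔ (σ a < σ b))
    (sym (lookup-ι′ i)) (sym (lookup-ι′ j)) (iso (opposite i) (opposite j))

-- The same occurrence works for the complements: opposite reverses order.
Contains-complement : ∀ {n k} {σ : Word n} {π : Fin k → Fin k} →
  Contains σ π → Contains (opposite ∘ σ) (opposite ∘ π)
Contains-complement (ι , increasing , iso) = ι , increasing , λ i j →
  mk⇔ (λ h → opposite-< (to   (iso j i) (opposite-<⁻ h)))
      (λ h → opposite-< (from (iso j i) (opposite-<⁻ h)))

-- Both operations are involutions, so each one-way lemma is an equivalence.
ExactlyOnce-reverse⇔ : ∀ {n} (σ : Word n) → ExactlyOnce (σ ∘ opposite) ⇔ ExactlyOnce σ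
ExactlyOnce-reverse⇔ σ = mk⇔
  (ExactlyOnce-cong (cong σ ∘ opposite-involutive) ∘ ExactlyOnce-reverse)
  ExactlyOnce-reverse

ExactlyOnce-complement⇔ : ∀ {n} (σ : Word n) → ExactlyOnce (opposite ∘ σ) ⇔ ExactlyOnce σ
ExactlyOnce-complement⇔ σ = mk⇔
  (ExactlyOnce-cong (opposite-involutive ∘ σ) ∘ ExactlyOnce-complement)
  ExactlyOnce-complement

Contains-reverse⇔ : ∀ {n k} (π : Fin k → Fin k) (σ : Word n) →
  Contains (σ ∘ opposite) (π ∘ opposite) ⇔ Contains σ π
Contains-reverse⇔ π σ = mk⇔
  (Contains-cong (cong σ ∘ opposite-involutive) (cong π ∘ opposite-involutive)
    ∘ Contains-reverse {σ = σ ∘ opposite})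
  (Contains-reverse {σ = σ})

Contains-complement⇔ : ∀ {n k} (π : Fin k → Fin k) (σ : Word n) →
  Contains (opposite ∘ σ) (opposite ∘ π) ⇔ Contains σ π
Contains-complement⇔ π σ = mk⇔
  (Contains-cong (opposite-involutive ∘ σ) (opposite-involutive ∘ π)
    ∘ Contains-complement {σ = opposite ∘ σ})
  (Contains-complement {σ = σ})

record GridSymmetry (n : ℕ) : Set where
  field
    onGrid             : Grid n → Grid n
    onWord             : Word n → Word n
    onIndex            : Fin n → Fin n
    onIndex-involutive : ∀ i → onIndex (onIndex i) ≡ i
    row-onGrid         : ∀ G r → row (onGrid G) r ≗ onWord (row G (onIndex r))
    col-onGrid         : ∀ G c → col (onGrid G) c ≗ onWord (col G (onIndex c))
    exactlyOnce⇔       : ∀ σ → ExactlyOnce (onWord σ) ⇔ ExactlyOnce σ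
    sumGrid-invariant  : Invariant (sumGrid n) onGrid

module _ {n} (Γ : GridSymmetry n) where
  open GridSymmetry Γ

  allLines⇔ : {P Q : Word n → Set} → (∀ {σ σ′} → σ ≗ σ′ → P σ → P σ′) →
    (∀ σ → P (onWord σ) ⇔ Q σ) → (lines′ lines : Fin n → Word n) →
    (∀ r → lines′ r ≗ onWord (lines (onIndex r))) →
    (∀ r → P (lines′ r)) ⇔ (∀ r → Q (lines r))
  allLines⇔ {P} {Q} P-cong P∘onWord⇔Q lines′ lines line-eq = mk⇔
    (λ all r → subst (Q ∘ lines) (onIndex-involutive r)
       (to (P∘onWord⇔Q _) (P-cong (line-eq (onIndex r)) (all (onIndex r)))))
    (λ all r → P-cong (sym ∘ line-eq r) (from (P∘onWord⇔Q _) (all (onIndex r))))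

  latinAvoids⇔ : ∀ {k} (π π′ : Fin k → Fin k) →
    (∀ σ → Contains (onWord σ) π′ ⇔ Contains σ π) →
    ∀ G → LatinAvoids π′ (onGrid G) ⇔ LatinAvoids π G
  latinAvoids⇔ π π′ contains⇔ G = mk⇔
    (λ ((rs , cs) , ra , ca) → ((to rows-once rs , to cols-once cs) ,
                                 to rows-avoid ra , to cols-avoid ca))
    (λ ((rs , cs) , ra , ca) → ((from rows-once rs , from cols-once cs) ,
                                 from rows-avoid ra , from cols-avoid ca))
    where
    avoids⇔ : ∀ σ → Avoids (onWord σ) π′ ⇔ Avoids σ π
    avoids⇔ σ = mk⇔ (λ a c → a (from (contains⇔ σ) c)) (λ a c → a (to (contains⇔ σ) c))
    rows-once  : (∀ r → ExactlyOnce (row (onGrid G) r)) ⇔ (∀ r → ExactlyOnce (row G r))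
    rows-once  = allLines⇔ ExactlyOnce-cong exactlyOnce⇔ (row (onGrid G)) (row G) (row-onGrid G)
    cols-once  : (∀ c → ExactlyOnce (col (onGrid G) c)) ⇔ (∀ c → ExactlyOnce (col G c))
    cols-once  = allLines⇔ ExactlyOnce-cong exactlyOnce⇔ (col (onGrid G)) (col G) (col-onGrid G)
    rows-avoid : (∀ r → Avoids (row (onGrid G) r) π′) ⇔ (∀ r → Avoids (row G r) π)
    rows-avoid = allLines⇔ (Avoids-cong {π = π′}) avoids⇔ (row (onGrid G)) (row G) (row-onGrid G)
    cols-avoid : (∀ c → Avoids (col (onGrid G) c) π′) ⇔ (∀ c → Avoids (col G c) π)
    cols-avoid = allLines⇔ (Avoids-cong {π = π′}) avoids⇔ (col (onGrid G)) (col G) (col-onGrid G)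

  L-symmetry : ∀ {k} (π π′ : Fin k → Fin k) →
    (∀ σ → Contains (onWord σ) π′ ⇔ Contains σ π) → L n π′ ≡ L n π
  L-symmetry π π′ contains⇔ =
    count-transport (latinAvoids? π′) (latinAvoids? π)
      (sumGrid-isSummation n) sumGrid-invariant
      (latinAvoids⇔ π π′ contains⇔)

complementSymmetry : ∀ n → GridSymmetry n
complementSymmetry n = record
  { onGrid             = map (map opposite)
  ; onWord             = opposite ∘_
  ; onIndex            = λ i → i
  ; onIndex-involutive = λ _ → refl
  ; row-onGrid         = λ G r c → lookup-complement G r c
  ; col-onGrid         = λ G c r → lookup-complement G r c
  ; exactlyOnce⇔       = ExactlyOnce-complement⇔
  ; sumGrid-invariant  = sumGrid-complement n
  }
  where
  lookup-complement : ∀ (G : Grid n) r c →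
    lookup (lookup (map (map opposite) G) r) c ≡ opposite (lookup (lookup G r) c)
  lookup-complement G r c =
    trans (cong (λ v → lookup v c) (lookup-map r (map opposite) G))
          (lookup-map c opposite (lookup G r))

lookup-∷ʳ-last : ∀ {A : Set} {m} (v : Vec A m) a → lookup (v ∷ʳ a) (fromℕ m) ≡ a
lookup-∷ʳ-last []      a = refl
lookup-∷ʳ-last (x ∷ v) a = lookup-∷ʳ-last v a

lookup-∷ʳ-inject₁ : ∀ {A : Set} {m} (v : Vec A m) a i → lookup (v ∷ʳ a) (inject₁ i) ≡ lookup v i
lookup-∷ʳ-inject₁ (x ∷ v) a zero    = refl
lookup-∷ʳ-inject₁ (x ∷ v) a (suc i) = lookup-∷ʳ-inject₁ v a i

lookup-reverse-opposite : ∀ {A : Set} {m} (v : Vec A m) i →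
  lookup (Vec.reverse v) (opposite i) ≡ lookup v i
lookup-reverse-opposite (x ∷ v) zero =
  trans (cong (λ w → lookup w (fromℕ _)) (reverse-∷ x v))
        (lookup-∷ʳ-last (Vec.reverse v) x)
lookup-reverse-opposite (x ∷ v) (suc i) =
  trans (cong (λ w → lookup w (inject₁ (opposite i))) (reverse-∷ x v))
        (trans (lookup-∷ʳ-inject₁ (Vec.reverse v) x (opposite i))
               (lookup-reverse-opposite v i))

rotationSymmetry : ∀ n → GridSymmetry n
rotationSymmetry n = record
  { onGrid             = map Vec.reverse ∘ Vec.reverse
  ; onWord             = _∘ opposite
  ; onIndex            = opposite
  ; onIndex-involutive = opposite-involutive
  ; row-onGrid         = λ G r c → lookup-rotate G r c
  ; col-onGrid         = λ G c r → lookup-rotate G r c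
  ; exactlyOnce⇔       = ExactlyOnce-reverse⇔
  ; sumGrid-invariant  = sumGrid-rotate n
  }
  where
  lookup-reverse : ∀ {A : Set} {m} (v : Vec A m) i → lookup (Vec.reverse v) i ≡ lookup v (opposite i)
  lookup-reverse v i =
    trans (cong (lookup (Vec.reverse v)) (sym (opposite-involutive i))) (lookup-reverse-opposite v (opposite i))
  lookup-rotate : ∀ (G : Grid n) r c → lookup (lookup (map Vec.reverse (Vec.reverse G)) r) c
                                       ≡ lookup (lookup G (opposite r)) (opposite c)
  lookup-rotate G r c = begin
    lookup (lookup (map Vec.reverse (Vec.reverse G)) r) c
      ≡⟨ cong (λ v → lookup v c) (lookup-map r Vec.reverse (Vec.reverse G)) ⟩
    lookup (Vec.reverse (lookup (Vec.reverse G) r)) c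
      ≡⟨ lookup-reverse (lookup (Vec.reverse G) r) c ⟩
    lookup (lookup (Vec.reverse G) r) (opposite c)
      ≡⟨ cong (λ v → lookup v (opposite c)) (lookup-reverse G r) ⟩
    lookup (lookup G (opposite r)) (opposite c) ∎
    where open ≡-Reasoning

L-reverse : ∀ n {k} (π : Fin k → Fin k) → L n (π ∘ opposite) ≡ L n π
L-reverse n π = L-symmetry (rotationSymmetry n) π (π ∘ opposite) (Contains-reverse⇔ π)

L-complement : ∀ n {k} (π : Fin k → Fin k) → L n (opposite ∘ π) ≡ L n π
L-complement n π = L-symmetry (complementSymmetry n) π (opposite ∘ π) (Contains-complement⇔ π)

theorem9 : ∀ (n : ℕ) → 1 ≤ n → ∀ (k : ℕ) (π : Permutation′ k) →
    (L n (π ⟨$⟩ʳ_) ≡ L n (reverse π)) × (L n (reverse π) ≡ L n (complement π))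
theorem9 n _ k π =
  sym (L-reverse n (π ⟨$⟩ʳ_)) ,
  trans (L-reverse n (π ⟨$⟩ʳ_)) (sym (L-complement n (π ⟨$⟩ʳ_)))
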